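{- Let $G$ be a series-parallel graph with minimum degree at least $3$. Suppose that no subgraph of $G$ is a subdivision of $G_4$. If $B$ is a block of $G$ isomorphic to the $3$-skein, then $B$ is an endblock of $G$.
   Context: Graphs may have loops and multiple edges; a loop contributes $2$ to the degree of its vertex. A graph is series-parallel if none of its subgraphs is a subdivision of $K_4$. A subdivision of a graph is obtained by replacing edges by paths with new internal vertices (subdividing a loop gives a cycle). The $k$-skein is the loopless graph with two vertices and $k$ edges between them. An endblock is a block containing at most one cut vertex of the graph. $G_4$ denotes any of the following graphs: vertices $u,v,y,z$ with three parallel edges between $u$ and $v$, an edge $uy$, an edge $vz$, a loop at $y$ and a loop at $z$, together with the graphs obtained from this one by contracting $uy$, or $vz$, or both. -}

module Defs where

open import Data.Nat using (ℕ; zero; suc; _+_; _<_)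
open import Data.Fin using (Fin; _≟_) renaming (zero to f0; suc to fs)
open import Data.Fin.Subset using (Subset; _∈_; _∉_; _⊆_; ⊤)
open import Data.Fin.Subset.Properties using (∈⊤)
open import Data.Product using (Σ; ∃; _×_; _,_; proj₁; proj₂)
open import Data.Sum using (_⊎_)
open import Data.List using (List; []; _∷_; map; concat; length; allFin)
open import Data.Nat.ListAction using (sum)
open import Data.List.Relation.Unary.All using (All)
open import Data.List.Relation.Unary.Unique.Propositional using (Unique)
open import Data.Vec using (Vec; lookup; _∷_; [])
open import Relation.Binary.PropositionalEquality using (_≡_; _≢_)
open import Relation.Nullary using (¬_; does)
open import Data.Bool using (if_then_else_)
open import Function.Definitions using (Injective)

-- Finite multigraphs (loops and parallel edges allowed).
-- Vertices Fin nV, edges Fin nE; each edge has an (unordered) pair of ends.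

record Graph : Set where
  field
    nV : ℕ
    nE : ℕ
    ends : Fin nE → Fin nV × Fin nV
open Graph public

Vtx : Graph → Set
Vtx G = Fin (nV G)

Edg : Graph → Set
Edg G = Fin (nE G)

Joins : (G : Graph) → Edg G → Vtx G → Vtx G → Set
Joins G e x y = (ends G e ≡ (x , y)) ⊎ (ends G e ≡ (y , x))

Incident : (G : Graph) → Edg G → Vtx G → Set
Incident G e v = (proj₁ (ends G e) ≡ v) ⊎ (proj₂ (ends G e) ≡ v)

-- degree: a loop contributes 2
deg : (G : Graph) → Vtx G → ℕ
deg G v = sum (map (λ e → (if does (proj₁ (ends G e) ≟ v) then 1 else 0)
                        + (if does (proj₂ (ends G e) ≟ v) then 1 else 0))
                   (allFin (nE G)))

data Walk (G : Graph) : Vtx G → Vtx G → Set where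
  nil  : ∀ {x} → Walk G x x
  cons : ∀ {x y z} (e : Edg G) → Joins G e x y → Walk G y z → Walk G x z

walkEdges : ∀ {G x y} → Walk G x y → List (Edg G)
walkEdges nil = []
walkEdges (cons e _ w) = e ∷ walkEdges w

initVerts : ∀ {G x y} → Walk G x y → List (Vtx G)
initVerts nil = []
initVerts (cons {x = x} e _ w) = x ∷ initVerts w

innerVerts : ∀ {G x y} → Walk G x y → List (Vtx G)
innerVerts nil = []
innerVerts (cons e _ w) = initVerts w

-- Branch vertices φ (injective); each edge ab of H becomes a walk of
-- length ≥ 1 from φ a to φ b in G (a cycle if a = b); all internal
-- vertices of all these walks are pairwise distinct and distinct from
-- branch vertices; all edges used are pairwise distinct.

record SubdivisionIn (H G : Graph) : Set where
  field
    φ      : Vtx H → Vtx G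
    φ-inj  : Injective _≡_ _≡_ φ
    path   : (e : Edg H) → Walk G (φ (proj₁ (ends H e))) (φ (proj₂ (ends H e)))
    path-nonempty : (e : Edg H) → 0 < length (walkEdges (path e))
    inner-unique  : Unique (concat (map (λ e → innerVerts (path e)) (allFin (nE H))))
    inner-new     : (e : Edg H) → All (λ w → ∀ a → φ a ≢ w) (innerVerts (path e))
    edges-unique  : Unique (concat (map (λ e → walkEdges (path e)) (allFin (nE H))))

fromList : (n k : ℕ) → Vec (Fin n × Fin n) k → Graph
fromList n k v = record { nV = n ; nE = k ; ends = lookup v }

private
  0F 1F 2F : ∀ {n} → Fin (suc (suc (suc n)))
  0F = f0
  1F = fs f0
  2F = fs (fs f0)
  3F : ∀ {n} → Fin (suc (suc (suc (suc n))))
  3F = fs (fs (fs f0))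

skein : ℕ → Graph
skein k = record { nV = 2 ; nE = k ; ends = λ _ → (f0 , fs f0) }

K4 : Graph
K4 = fromList 4 6 ((0F , 1F) ∷ (0F , 2F) ∷ (0F , 3F) ∷ (1F , 2F) ∷ (1F , 3F) ∷ (2F , 3F) ∷ [])

-- G4 with u = 0, v = 1, y = 2, z = 3
G4-base : Graph
G4-base = fromList 4 7 ((0F , 1F) ∷ (0F , 1F) ∷ (0F , 1F) ∷ (0F , 2F) ∷ (1F , 3F) ∷ (2F , 2F) ∷ (3F , 3F) ∷ [])

-- uy contracted: u = 0, v = 1, z = 2
G4-uy : Graph
G4-uy = fromList 3 6 ((0F , 1F) ∷ (0F , 1F) ∷ (0F , 1F) ∷ (1F , 2F) ∷ (0F , 0F) ∷ (2F , 2F) ∷ [])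

-- vz contracted: u = 0, v = 1, y = 2
G4-vz : Graph
G4-vz = fromList 3 6 ((0F , 1F) ∷ (0F , 1F) ∷ (0F , 1F) ∷ (0F , 2F) ∷ (2F , 2F) ∷ (1F , 1F) ∷ [])

-- both contracted: u = 0, v = 1
G4-both : Graph
G4-both = fromList 2 5 ((f0 , fs f0) ∷ (f0 , fs f0) ∷ (f0 , fs f0) ∷ (f0 , f0) ∷ (fs f0 , fs f0) ∷ [])

data IsG4 : Graph → Set where
  g4-base : IsG4 G4-base
  g4-uy   : IsG4 G4-uy
  g4-vz   : IsG4 G4-vz
  g4-both : IsG4 G4-both

SeriesParallel : Graph → Set
SeriesParallel G = ¬ SubdivisionIn K4 G

record Subgraph (G : Graph) : Set where
  field
    vs : Subset (nV G)
    es : Subset (nE G)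
    closed : ∀ e → e ∈ es → (proj₁ (ends G e) ∈ vs) × (proj₂ (ends G e) ∈ vs)
open Subgraph public

whole : (G : Graph) → Subgraph G
whole G = record { vs = ⊤ ; es = ⊤ ; closed = λ e _ → ∈⊤ , ∈⊤ }

_⊑_ : ∀ {G} → Subgraph G → Subgraph G → Set
S ⊑ T = (vs S ⊆ vs T) × (es S ⊆ es T)

-- cut vertex (Bondy–Murty definition, suitable for graphs with loops):
-- v is a cut vertex of S if es S can be partitioned into two nonempty
-- sets E1, E2 whose edge-induced subgraphs have exactly v in common.
CutVertexOf : ∀ {G} → Subgraph G → Vtx G → Set
CutVertexOf {G} S v =
  (v ∈ vs S) ×
  Σ (Subset (nE G)) λ E1 →
    (E1 ⊆ es S) ×
    (∃ λ e → e ∈ E1) ×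
    (∃ λ e → (e ∈ es S) × (e ∉ E1)) ×
    (∀ w → ((∃ λ e → (e ∈ E1) × Incident G e w) ×
            (∃ λ e → (e ∈ es S) × (e ∉ E1) × Incident G e w) → w ≡ v)
         × (w ≡ v → (∃ λ e → (e ∈ E1) × Incident G e w) ×
                    (∃ λ e → (e ∈ es S) × (e ∉ E1) × Incident G e w)))

CutVertex : (G : Graph) → Vtx G → Set
CutVertex G v = CutVertexOf (whole G) v

Connected : ∀ {G} → Subgraph G → Set
Connected {G} S =
  (∃ λ v → v ∈ vs S) ×
  (∀ x y → x ∈ vs S → y ∈ vs S →
     Σ (Walk G x y) λ w → All (λ e → e ∈ es S) (walkEdges w))

Nonseparable : ∀ {G} → Subgraph G → Set
Nonseparable S = Connected S × (∀ v → ¬ CutVertexOf S v)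

Block : ∀ {G} → Subgraph G → Set
Block {G} S = Nonseparable S × (∀ (T : Subgraph G) → S ⊑ T → Nonseparable T → T ⊑ S)

Endblock : ∀ {G} → Subgraph G → Set
Endblock {G} S = Block S ×
  (∀ x y → x ∈ vs S → y ∈ vs S → CutVertex G x → CutVertex G y → x ≡ y)

IsoTo : ∀ {G} → Graph → Subgraph G → Set
IsoTo {G} H S =
  Σ (Vtx H → Vtx G) λ φ →
  Σ (Edg H → Edg G) λ ψ →
    Injective _≡_ _≡_ φ × (∀ v → v ∈ vs S → ∃ λ a → φ a ≡ v) × (∀ a → φ a ∈ vs S) ×
    Injective _≡_ _≡_ ψ × (∀ e → e ∈ es S → ∃ λ f → ψ f ≡ e) × (∀ f → ψ f ∈ es S) ×
    (∀ f → Joins G (ψ f) (φ (proj₁ (ends H f))) (φ (proj₂ (ends H f))))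

-- Suppose both ends a, b of a 3-skein block were cut vertices.  Each splits the
-- edges into two sides; call an edge good if it lies on the side of a away from
-- the skein but not on the side of b away from the skein.  At every vertex other
-- than a that meets a good edge, all edges are good, so by minimum degree 3 a
-- walk from a along good edges can always continue until it closes a cycle: a
-- lollipop rooted at a.  Symmetrically there is a lollipop rooted at b, and the
-- two are disjoint from each other and from the skein.  Together with the three
-- parallel edges they form a subdivision of G4 (with uy or vz contracted when a
-- stem is trivial), which is excluded.

module Submission where

open import Defs
open import Data.Nat using (ℕ; zero; suc; _+_; _≤_; _<_; z≤n; s≤s)
import Data.Nat.Properties
open import Data.Nat.Properties using (+-identityʳ; +-comm; +-suc; ≤-trans; <-irrefl; <⇒≱; n≤1+n)
open import Data.Fin using (Fin; _≟_) renaming (zero to f0; suc to fs)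
open import Data.Fin.Properties using (suc-injective; any?; injective⇒≤)
open import Data.Fin.Subset using (Subset; ∁) renaming (_∈_ to _∈ₛ_; _∉_ to _∉ₛ_)
open import Data.Fin.Subset.Properties
  using (∈⊤; x∈p⇒x∉∁p; x∈∁p⇒x∉p; x∉∁p⇒x∈p; x∉p⇒x∈∁p) renaming (_∈?_ to _∈ₛ?_)
open import Data.Product using (Σ; ∃; _×_; _,_; proj₁; proj₂)
open import Data.Sum using (_⊎_; inj₁; inj₂)
open import Data.Empty using (⊥; ⊥-elim)
open import Data.Bool using (if_then_else_)
open import Data.List using (List; []; _∷_; _++_; length; map; concat; allFin; tabulate; lookup)
open import Data.List.Properties using (length-++; map-tabulate; tabulate-lookup)
open import Data.Nat.ListAction using (sum)
open import Data.List.Relation.Unary.All as All using (All; []; _∷_)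
import Data.List.Relation.Unary.All.Properties as AllP
open import Data.List.Relation.Unary.Any using (here; there)
open import Data.List.Relation.Unary.Unique.Propositional using (Unique; []; _∷_)
import Data.List.Relation.Unary.Unique.Propositional.Properties as UniqueP
open import Data.List.Relation.Binary.Disjoint.Propositional using (Disjoint)
open import Data.List.Membership.Propositional using (_∈_; _∉_)
open import Data.List.Membership.Propositional.Properties
  using (∈-++⁻; ∈-++⁺ʳ; ∈-tabulate⁺; ∈-tabulate⁻; ∈-map⁺; ∈-concat⁺′; ∈-allFin)
import Data.List.Membership.DecPropositional as DecMembership
open import Data.List.Relation.Binary.Permutation.Propositional
  using (_↭_; ↭-refl; ↭-reflexive; ↭-trans; ↭-prep; ↭⇒↭ₛ)
open import Data.List.Relation.Binary.Permutation.Propositional.Properties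
  using (++-commutativeMonoid; ++⁺; ++⁺ˡ; ++-comm; shift)
import Data.List.Relation.Binary.Permutation.Setoid.Properties as PermutationSetoid
open import Relation.Binary.PropositionalEquality
  using (_≡_; _≢_; refl; sym; trans; cong; cong₂; subst; setoid; module ≡-Reasoning)
open import Relation.Nullary using (¬_; yes; no; does; ¬?)
open import Relation.Nullary.Decidable using (_×-dec_; _⊎-dec_)
open import Function using (_∘_)
open import Function.Definitions using (Injective)

module _ {A : Set} where

  Unique-++⁻ : ∀ xs {ys : List A} → Unique (xs ++ ys) → Unique xs × Unique ys × Disjoint xs ys
  Unique-++⁻ [] u = [] , u , λ { (() , _) }
  Unique-++⁻ (x ∷ xs) (x∉ ∷ u) with Unique-++⁻ xs u
  ... | uxs , uys , disjoint = AllP.++⁻ˡ xs x∉ ∷ uxs , uys , λ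
    { (here refl , v∈ys) → All.lookup (AllP.++⁻ʳ xs x∉) v∈ys refl
    ; (there v∈xs , v∈ys) → disjoint (v∈xs , v∈ys) }

  Unique-resp-↭ : ∀ {xs ys : List A} → xs ↭ ys → Unique xs → Unique ys
  Unique-resp-↭ p = PermutationSetoid.Unique-resp-↭ (setoid A) (↭⇒↭ₛ p)

  Unique-tabulate⇒injective : ∀ {n} {f : Fin n → A} → Unique (tabulate f) → ∀ {i j} → f i ≡ f j → i ≡ j
  Unique-tabulate⇒injective _ {f0} {f0} _ = refl
  Unique-tabulate⇒injective (f0∉ ∷ _) {f0} {fs j} eq = ⊥-elim (All.lookup f0∉ (∈-tabulate⁺ j) eq)
  Unique-tabulate⇒injective (f0∉ ∷ _) {fs i} {f0} eq = ⊥-elim (All.lookup f0∉ (∈-tabulate⁺ i) (sym eq))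
  Unique-tabulate⇒injective (_ ∷ u) {fs i} {fs j} eq = cong fs (Unique-tabulate⇒injective u eq)

module _ {A : Set} where
  open import Algebra.Solver.CommutativeMonoid (++-commutativeMonoid {A = A})

  ↭-interleave : (a₁ b₁ a₂ b₂ : List A) → (a₁ ++ b₁) ++ (a₂ ++ b₂) ↭ a₁ ++ a₂ ++ b₁ ++ b₂ ++ []
  ↭-interleave = solve 4 (λ a₁ b₁ a₂ b₂ → (a₁ ⊕ b₁) ⊕ (a₂ ⊕ b₂) ⊜ a₁ ⊕ a₂ ⊕ b₁ ⊕ b₂ ⊕ id) ↭-refl

  ↭-gather : (x x′ : A) (xs ys xs′ ys′ : List A) →
             (x ∷ xs ++ ys) ++ (x′ ∷ xs′ ++ ys′) ↭ (x ∷ x′ ∷ xs ++ xs′) ++ ys ++ ys′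
  ↭-gather x x′ = solve 6 (λ x x′ xs ys xs′ ys′ →
                             (x ⊕ xs ⊕ ys) ⊕ (x′ ⊕ xs′ ⊕ ys′) ⊜ (x ⊕ x′ ⊕ xs ⊕ xs′) ⊕ ys ⊕ ys′)
                      ↭-refl (x ∷ []) (x′ ∷ [])

Unique⇒length≤ : ∀ {n} {xs : List (Fin n)} → Unique xs → length xs ≤ n
Unique⇒length≤ {xs = xs} u =
  injective⇒≤ (Unique-tabulate⇒injective (subst Unique (sym (tabulate-lookup xs)) u))

sum-tabulate-zero : ∀ {n} (h : Fin n → ℕ) → (∀ i → h i ≡ 0) → sum (tabulate h) ≡ 0
sum-tabulate-zero {zero}  h h≡0 = refl
sum-tabulate-zero {suc n} h h≡0 = cong₂ _+_ (h≡0 f0) (sum-tabulate-zero (h ∘ fs) (h≡0 ∘ fs))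

sum-tabulate-single : ∀ {n} (h : Fin n → ℕ) (k : Fin n) → (∀ i → i ≢ k → h i ≡ 0) → sum (tabulate h) ≡ h k
sum-tabulate-single h f0 h≡0 =
  trans (cong (h f0 +_) (sum-tabulate-zero (h ∘ fs) (λ i → h≡0 (fs i) λ ()))) (+-identityʳ (h f0))
sum-tabulate-single h (fs k) h≡0 =
  cong₂ _+_ (h≡0 f0 λ ()) (sum-tabulate-single (h ∘ fs) k (λ i i≢k → h≡0 (fs i) (i≢k ∘ suc-injective)))

module _ (G : Graph) where

  endsAt : Vtx G → Edg G → ℕ
  endsAt v e = (if does (proj₁ (ends G e) ≟ v) then 1 else 0) + (if does (proj₂ (ends G e) ≟ v) then 1 else 0)

  endsAt≤2 : ∀ v e → endsAt v e ≤ 2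
  endsAt≤2 v e with proj₁ (ends G e) ≟ v | proj₂ (ends G e) ≟ v
  ... | yes _ | yes _ = s≤s (s≤s z≤n)
  ... | yes _ | no _  = s≤s z≤n
  ... | no _  | yes _ = s≤s z≤n
  ... | no _  | no _  = z≤n

  endsAt-nonincident : ∀ {v e} → ¬ Incident G e v → endsAt v e ≡ 0
  endsAt-nonincident {v} {e} ¬inc with proj₁ (ends G e) ≟ v | proj₂ (ends G e) ≟ v
  ... | yes p | _     = ⊥-elim (¬inc (inj₁ p))
  ... | no _  | yes q = ⊥-elim (¬inc (inj₂ q))
  ... | no _  | no _  = refl

  only-incident-edge⇒deg≤2 : ∀ {v} (f : Edg G) → (∀ g → g ≢ f → ¬ Incident G g v) → deg G v ≤ 2
  only-incident-edge⇒deg≤2 {v} f only-f = begin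
    deg G v                       ≡⟨ cong sum (map-tabulate (λ e → e) (endsAt v)) ⟩
    sum (tabulate (endsAt v))     ≡⟨ sum-tabulate-single (endsAt v) f (λ g g≢f → endsAt-nonincident (only-f g g≢f)) ⟩
    endsAt v f                    ≤⟨ endsAt≤2 v f ⟩
    2                             ∎
    where open Data.Nat.Properties.≤-Reasoning

  another-incident-edge : ∀ {v} → 3 ≤ deg G v → (f : Edg G) → ∃ λ g → g ≢ f × Incident G g v
  another-incident-edge {v} 3≤deg f
    with any? (λ g → ¬? (g ≟ f) ×-dec (proj₁ (ends G g) ≟ v ⊎-dec proj₂ (ends G g) ≟ v))
  ... | yes found = found
  ... | no none   = ⊥-elim (<-irrefl refl (≤-trans 3≤deg deg≤2))
    where
    deg≤2 : deg G v ≤ 2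
    deg≤2 = only-incident-edge⇒deg≤2 f (λ g g≢f inc → none (g , g≢f , inc))

module Walks (G : Graph) where

  infixr 5 _++ʷ_

  _++ʷ_ : ∀ {x y z} → Walk G x y → Walk G y z → Walk G x z
  nil ++ʷ w′ = w′
  cons e j w ++ʷ w′ = cons e j (w ++ʷ w′)

  edge : ∀ {e x y} → Joins G e x y → Walk G x y
  edge {e} j = cons e j nil

  verts : ∀ {x y} → Walk G x y → List (Vtx G)
  verts {y = y} w = initVerts w ++ y ∷ []

  ++ʷ-assoc : ∀ {x y z t} (w₁ : Walk G x y) (w₂ : Walk G y z) (w₃ : Walk G z t) →
              (w₁ ++ʷ w₂) ++ʷ w₃ ≡ w₁ ++ʷ (w₂ ++ʷ w₃)
  ++ʷ-assoc nil          w₂ w₃ = refl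
  ++ʷ-assoc (cons e j w) w₂ w₃ = cong (cons e j) (++ʷ-assoc w w₂ w₃)

  initVerts-++ʷ : ∀ {x y z} (w : Walk G x y) (w′ : Walk G y z) →
                  initVerts (w ++ʷ w′) ≡ initVerts w ++ initVerts w′
  initVerts-++ʷ nil                    w′ = refl
  initVerts-++ʷ (cons {x = x} e j w) w′ = cong (x ∷_) (initVerts-++ʷ w w′)

  walkEdges-++ʷ : ∀ {x y z} (w : Walk G x y) (w′ : Walk G y z) →
                  walkEdges (w ++ʷ w′) ≡ walkEdges w ++ walkEdges w′
  walkEdges-++ʷ nil          w′ = refl
  walkEdges-++ʷ (cons e j w) w′ = cong (e ∷_) (walkEdges-++ʷ w w′)

  ++ʷ-edge-nonempty : ∀ {x y z e} (w : Walk G x y) (j : Joins G e y z) → 0 < length (walkEdges (w ++ʷ edge j))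
  ++ʷ-edge-nonempty nil          _ = s≤s z≤n
  ++ʷ-edge-nonempty (cons _ _ _) _ = s≤s z≤n

  verts-++ʷ-edge : ∀ {x y z e} (w : Walk G x y) (j : Joins G e y z) → verts (w ++ʷ edge j) ≡ verts w ++ z ∷ []
  verts-++ʷ-edge {z = z} w j = cong (_++ z ∷ []) (initVerts-++ʷ w (edge j))

  start∈verts : ∀ {x y} (w : Walk G x y) → x ∈ verts w
  start∈verts nil          = here refl
  start∈verts (cons e j w) = here refl

  split-at : ∀ {x y q} (w : Walk G x y) → q ∈ verts w →
             Σ (Walk G x q) λ w₁ → Σ (Walk G q y) λ w₂ → w ≡ w₁ ++ʷ w₂
  split-at nil          (here refl) = nil , nil , refl
  split-at (cons e j w) (here refl) = nil , cons e j w , refl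
  split-at (cons e j w) (there q∈) with split-at w q∈
  ... | w₁ , w₂ , refl = cons e j w₁ , w₂ , refl

  Joins-sym : ∀ {e x y} → Joins G e x y → Joins G e y x
  Joins-sym (inj₁ eq) = inj₂ eq
  Joins-sym (inj₂ eq) = inj₁ eq

  Joins⇒Incidentˡ : ∀ {e x y} → Joins G e x y → Incident G e x
  Joins⇒Incidentˡ (inj₁ eq) = inj₁ (cong proj₁ eq)
  Joins⇒Incidentˡ (inj₂ eq) = inj₂ (cong proj₂ eq)

  Joins⇒Incidentʳ : ∀ {e x y} → Joins G e x y → Incident G e y
  Joins⇒Incidentʳ = Joins⇒Incidentˡ ∘ Joins-sym

  Incident⇒Joins : ∀ {e v} → Incident G e v → ∃ λ q → Joins G e v q
  Incident⇒Joins {e} (inj₁ eq) = proj₂ (ends G e) , inj₁ (cong (_, proj₂ (ends G e)) eq)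
  Incident⇒Joins {e} (inj₂ eq) = proj₁ (ends G e) , inj₂ (cong (proj₁ (ends G e) ,_) eq)

  Incident-Joins : ∀ {e x y v} → Joins G e x y → Incident G e v → v ≡ x ⊎ v ≡ y
  Incident-Joins (inj₁ j) (inj₁ i) = inj₁ (trans (sym i) (cong proj₁ j))
  Incident-Joins (inj₁ j) (inj₂ i) = inj₂ (trans (sym i) (cong proj₂ j))
  Incident-Joins (inj₂ j) (inj₁ i) = inj₂ (trans (sym i) (cong proj₁ j))
  Incident-Joins (inj₂ j) (inj₂ i) = inj₁ (trans (sym i) (cong proj₂ j))

  Incident⇒∈verts : ∀ {x y e v} (w : Walk G x y) → e ∈ walkEdges w → Incident G e v → v ∈ verts w
  Incident⇒∈verts (cons e j w) (here refl) inc with Incident-Joins j inc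
  ... | inj₁ refl = here refl
  ... | inj₂ refl = there (start∈verts w)
  Incident⇒∈verts (cons e j w) (there e∈) inc = there (Incident⇒∈verts w e∈ inc)

  initVert⇒Incident : ∀ {x y v} (w : Walk G x y) → v ∈ initVerts w →
                      ∃ λ e → e ∈ walkEdges w × Incident G e v
  initVert⇒Incident (cons e j w) (here refl) = e , here refl , Joins⇒Incidentˡ j
  initVert⇒Incident (cons e j w) (there v∈) with initVert⇒Incident w v∈
  ... | e′ , e′∈ , inc = e′ , there e′∈ , inc

-- Lollipops

record Lollipop (G : Graph) (root : Vtx G) : Set where
  constructor lollipop
  open Walks G
  field
    {tip}           : Vtx G
    stem            : Walk G root tip
    cycle           : Walk G tip tip
    cycle-nonempty  : 0 < length (walkEdges cycle)
    vertices-unique : Unique (initVerts (stem ++ʷ cycle))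
    edges-unique    : Unique (walkEdges (stem ++ʷ cycle))

module _ {G : Graph} {root : Vtx G} where
  open Walks G
  open Lollipop

  vertices : Lollipop G root → List (Vtx G)
  vertices L = initVerts (stem L ++ʷ cycle L)

  edges : Lollipop G root → List (Edg G)
  edges L = walkEdges (stem L ++ʷ cycle L)

  -- The tip is a vertex of its own only when the stem is nonempty.
  tips : Lollipop G root → List (Vtx G)
  tips (lollipop nil          _ _ _ _) = []
  tips (lollipop {tip} (cons _ _ _) _ _ _ _) = tip ∷ []

  inner : Lollipop G root → List (Vtx G)
  inner L = innerVerts (stem L) ++ innerVerts (cycle L)

  vertices-↭ : (L : Lollipop G root) → vertices L ↭ root ∷ tips L ++ inner L
  vertices-↭ (lollipop nil          nil           () _ _)
  vertices-↭ (lollipop nil          (cons _ _ _)  _  _ _) = ↭-refl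
  vertices-↭ (lollipop (cons _ _ _) nil           () _ _)
  vertices-↭ (lollipop {tip} (cons _ _ w) (cons e j w′) _ _ _)
    rewrite initVerts-++ʷ w (cons e j w′) = ↭-prep root (shift tip (initVerts w) (initVerts w′))

  vertex-on-edge : ∀ {v} (L : Lollipop G root) → v ∈ vertices L → ∃ λ e → e ∈ edges L × Incident G e v
  vertex-on-edge L = initVert⇒Incident (stem L ++ʷ cycle L)

ClosedAwayFrom : (G : Graph) → (Edg G → Set) → Vtx G → Set
ClosedAwayFrom G Good a = ∀ {p e e′} → p ≢ a → Good e → Incident G e p → Incident G e′ p → Good e′

module LollipopSearch {G : Graph} (deg≥3 : ∀ v → 3 ≤ deg G v) {Good : Edg G → Set} {a : Vtx G}
                      (closed : ClosedAwayFrom G Good a) where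
  open Walks G

  GoodLollipop : Set
  GoodLollipop = Σ (Lollipop G a) λ L → All Good (edges L)

  record GoodPath : Set where
    constructor goodPath
    field
      {end next}   : Vtx G
      walk         : Walk G a end
      {last}       : Edg G
      last-joins   : Joins G last end next
      verts-unique : Unique (verts (walk ++ʷ edge last-joins))
      edges-unique : Unique (walkEdges (walk ++ʷ edge last-joins))
      edges-good   : All Good (walkEdges (walk ++ʷ edge last-joins))

    size : ℕ
    size = length (verts (walk ++ʷ edge last-joins))

  module Step (P : GoodPath) {g q} (g≢last : g ≢ GoodPath.last P) (gj : Joins G g (GoodPath.next P) q) where
    open GoodPath P

    next∉walk : next ∉ verts walk
    next∉walk next∈ with Unique-++⁻ (verts walk) (subst Unique (verts-++ʷ-edge walk last-joins) verts-unique)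
    ... | _ , _ , disjoint = disjoint (next∈ , here refl)

    g-good : Good g
    g-good = closed (λ { refl → next∉walk (start∈verts walk) })
                    (All.lookup edges-good (subst (last ∈_) (sym (walkEdges-++ʷ walk (edge last-joins)))
                                                  (∈-++⁺ʳ (walkEdges walk) (here refl))))
                    (Joins⇒Incidentʳ last-joins) (Joins⇒Incidentˡ gj)

    closing : Walk G a q
    closing = (walk ++ʷ edge last-joins) ++ʷ edge gj

    closing-verts : initVerts closing ≡ verts (walk ++ʷ edge last-joins)
    closing-verts = initVerts-++ʷ (walk ++ʷ edge last-joins) (edge gj)

    closing-edges : walkEdges closing ≡ walkEdges (walk ++ʷ edge last-joins) ++ g ∷ []
    closing-edges = walkEdges-++ʷ (walk ++ʷ edge last-joins) (edge gj)

    closing-edges-unique : Unique (walkEdges closing)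
    closing-edges-unique = subst Unique (sym closing-edges)
      (UniqueP.++⁺ edges-unique ([] ∷ []) λ { (g∈ , here refl) → g∉ g∈ })
      where
      g∉ : g ∉ walkEdges (walk ++ʷ edge last-joins)
      g∉ g∈ with ∈-++⁻ (walkEdges walk) (subst (g ∈_) (walkEdges-++ʷ walk (edge last-joins)) g∈)
      ... | inj₁ g∈walk      = next∉walk (Incident⇒∈verts walk g∈walk (Joins⇒Incidentˡ gj))
      ... | inj₂ (here refl) = g≢last refl

    closing-edges-good : All Good (walkEdges closing)
    closing-edges-good = subst (All Good) (sym closing-edges) (AllP.++⁺ edges-good (g-good ∷ []))

    close : (S : Walk G a q) (C : Walk G q q) → 0 < length (walkEdges C) → S ++ʷ C ≡ closing → GoodLollipop
    close S C C-nonempty S++C≡closing =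
      lollipop S C C-nonempty
        (subst (Unique ∘ initVerts) (sym S++C≡closing) (subst Unique (sym closing-verts) verts-unique))
        (subst (Unique ∘ walkEdges) (sym S++C≡closing) closing-edges-unique) ,
      subst (All Good ∘ walkEdges) (sym S++C≡closing) closing-edges-good

    extend : q ≢ next → q ∉ verts walk → Σ GoodPath λ P′ → GoodPath.size P′ ≡ suc size
    extend q≢next q∉walk =
      goodPath (walk ++ʷ edge last-joins) gj
        (subst Unique (sym (verts-++ʷ-edge (walk ++ʷ edge last-joins) gj))
           (UniqueP.++⁺ verts-unique ([] ∷ []) λ { (q∈ , here refl) → q∉ q∈ }))
        closing-edges-unique closing-edges-good ,
      trans (cong length (verts-++ʷ-edge (walk ++ʷ edge last-joins) gj))
            (trans (length-++ (verts (walk ++ʷ edge last-joins))) (+-comm size 1))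
      where
      q∉ : q ∉ verts (walk ++ʷ edge last-joins)
      q∉ q∈ with ∈-++⁻ (verts walk) (subst (q ∈_) (verts-++ʷ-edge walk last-joins) q∈)
      ... | inj₁ q∈walk      = q∉walk q∈walk
      ... | inj₂ (here refl) = q≢next refl

  step : (P : GoodPath) → GoodLollipop ⊎ Σ GoodPath λ P′ → GoodPath.size P′ ≡ suc (GoodPath.size P)
  step P@(goodPath {next = c} walk {last = f} f-joins _ _ _) with another-incident-edge G (deg≥3 c) f
  ... | g , g≢f , g-inc with Incident⇒Joins g-inc
  ... | q , gj with q ≟ c | DecMembership._∈?_ _≟_ q (verts walk)
  ...   | yes refl | _     = inj₁ (Step.close P g≢f gj (walk ++ʷ edge f-joins) (edge gj) (s≤s z≤n) refl)
  ...   | no q≢c   | no q∉ = inj₂ (Step.extend P g≢f gj q≢c q∉)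
  ...   | no q≢c   | yes q∈ with split-at walk q∈
  ...     | w₁ , w₂ , refl =
    inj₁ (Step.close P g≢f gj w₁ ((w₂ ++ʷ edge f-joins) ++ʷ edge gj) (++ʷ-edge-nonempty (w₂ ++ʷ edge f-joins) gj)
                     reassociate)
    where
    open ≡-Reasoning
    reassociate : w₁ ++ʷ ((w₂ ++ʷ edge f-joins) ++ʷ edge gj) ≡ ((w₁ ++ʷ w₂) ++ʷ edge f-joins) ++ʷ edge gj
    reassociate = begin
      w₁ ++ʷ ((w₂ ++ʷ edge f-joins) ++ʷ edge gj)   ≡⟨ cong (w₁ ++ʷ_) (++ʷ-assoc w₂ (edge f-joins) (edge gj)) ⟩
      w₁ ++ʷ (w₂ ++ʷ (edge f-joins ++ʷ edge gj))   ≡⟨ sym (++ʷ-assoc w₁ w₂ (edge f-joins ++ʷ edge gj)) ⟩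
      (w₁ ++ʷ w₂) ++ʷ (edge f-joins ++ʷ edge gj)   ≡⟨ sym (++ʷ-assoc (w₁ ++ʷ w₂) (edge f-joins) (edge gj)) ⟩
      ((w₁ ++ʷ w₂) ++ʷ edge f-joins) ++ʷ edge gj   ∎

  -- A good path has distinct vertices, so it can be extended fewer than nV G times.
  search : (fuel : ℕ) (P : GoodPath) → nV G < GoodPath.size P + fuel → GoodLollipop
  search zero P bound =
    ⊥-elim (<⇒≱ (subst (nV G <_) (+-identityʳ _) bound) (Unique⇒length≤ (GoodPath.verts-unique P)))
  search (suc fuel) P bound with step P
  ... | inj₁ L            = L
  ... | inj₂ (P′ , size≡) =
    search fuel P′ (subst (nV G <_) (trans (+-suc (GoodPath.size P) fuel) (cong (_+ fuel) (sym size≡))) bound)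

  good-lollipop : ∀ {e₀} → Good e₀ → Incident G e₀ a → GoodLollipop
  good-lollipop good inc with Incident⇒Joins inc
  ... | c , j with c ≟ a
  ... | yes refl = lollipop nil (edge j) (s≤s z≤n) ([] ∷ []) ([] ∷ []) , good ∷ []
  ... | no c≢a   = search (nV G) (goodPath nil j (((c≢a ∘ sym) ∷ []) ∷ [] ∷ []) ([] ∷ []) (good ∷ []))
                          (s≤s (n≤1+n (nV G)))

-- Separations

record Separation (G : Graph) (v : Vtx G) : Set where
  field
    side          : Subset (nE G)
    meets-only-at : ∀ {w e e′} → e ∈ₛ side → e′ ∉ₛ side → Incident G e w → Incident G e′ w → w ≡ v
    side-at       : ∃ λ e → e ∈ₛ side × Incident G e v

  side-closed : ∀ {p e e′} → p ≢ v → e ∈ₛ side → Incident G e p → Incident G e′ p → e′ ∈ₛ side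
  side-closed {e′ = e′} p≢v e∈ inc inc′ with e′ ∈ₛ? side
  ... | yes e′∈ = e′∈
  ... | no  e′∉ = ⊥-elim (p≢v (meets-only-at e∈ e′∉ inc inc′))

open Separation

cutVertex⇒separation : ∀ {G v} → CutVertex G v → (e₀ : Edg G) → Σ (Separation G v) λ S → e₀ ∉ₛ side S
cutVertex⇒separation {G} {v} (_ , E₁ , _ , _ , _ , meet) e₀ with e₀ ∈ₛ? E₁
... | yes e₀∈ = record { side = ∁ E₁ ; meets-only-at = meets ; side-at = at } , x∈p⇒x∉∁p e₀∈
  where
  meets : ∀ {w e e′} → e ∈ₛ ∁ E₁ → e′ ∉ₛ ∁ E₁ → Incident G e w → Incident G e′ w → w ≡ v
  meets {w} {e} {e′} e∈ e′∉ inc inc′ =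
    proj₁ (meet w) ((e′ , x∉∁p⇒x∈p e′∉ , inc′) , (e , ∈⊤ , x∈∁p⇒x∉p e∈ , inc))
  at : ∃ λ e → e ∈ₛ ∁ E₁ × Incident G e v
  at with proj₂ (meet v) refl
  ... | _ , (e , _ , e∉ , inc) = e , x∉p⇒x∈∁p e∉ , inc
... | no e₀∉ = record { side = E₁ ; meets-only-at = meets ; side-at = proj₁ (proj₂ (meet v) refl) } , e₀∉
  where
  meets : ∀ {w e e′} → e ∈ₛ E₁ → e′ ∉ₛ E₁ → Incident G e w → Incident G e′ w → w ≡ v
  meets {w} {e} {e′} e∈ e′∉ inc inc′ = proj₁ (meet w) ((e , e∈ , inc) , (e′ , ∈⊤ , e′∉ , inc′))

module TwoSeparations {G : Graph} {a b : Vtx G} (a≢b : a ≢ b) (Sa : Separation G a) (Sb : Separation G b)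
                      {e₀ : Edg G} (j₀ : Joins G e₀ a b) (e₀∉Sa : e₀ ∉ₛ side Sa) (e₀∉Sb : e₀ ∉ₛ side Sb) where
  open Walks G

  OwnSide : Edg G → Set
  OwnSide e = e ∈ₛ side Sa × e ∉ₛ side Sb

  joining-edge∉side : ∀ {e} → Joins G e a b → e ∉ₛ side Sa
  joining-edge∉side j e∈ = a≢b (sym (meets-only-at Sa e∈ e₀∉Sa (Joins⇒Incidentʳ j) (Joins⇒Incidentʳ j₀)))

  OwnSide-closed : ClosedAwayFrom G OwnSide a
  OwnSide-closed {p} {e} {e′} p≢a (e∈Sa , e∉Sb) inc inc′ = side-closed Sa p≢a e∈Sa inc inc′ , e′∉Sb
    where
    e′∉Sb : e′ ∉ₛ side Sb
    e′∉Sb e′∈Sb with meets-only-at Sb e′∈Sb e∉Sb inc′ inc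
    ... | refl = a≢b (sym (meets-only-at Sa e∈Sa e₀∉Sa inc (Joins⇒Incidentʳ j₀)))

  OwnSide-edge-at-root : ∃ λ e → OwnSide e × Incident G e a
  OwnSide-edge-at-root with side-at Sa
  ... | e , e∈Sa , inc = e , (e∈Sa , e∉Sb) , inc
    where
    e∉Sb : e ∉ₛ side Sb
    e∉Sb e∈Sb = a≢b (meets-only-at Sb e∈Sb e₀∉Sb inc (Joins⇒Incidentˡ j₀))

  OwnSide-lollipop : (∀ v → 3 ≤ deg G v) → Σ (Lollipop G a) λ L → All OwnSide (edges L)
  OwnSide-lollipop deg≥3 with OwnSide-edge-at-root
  ... | e , own , inc = LollipopSearch.good-lollipop deg≥3 OwnSide-closed own inc

  OwnSides-meet-nowhere : ∀ {e e′ w} → OwnSide e → e′ ∈ₛ side Sb → e′ ∉ₛ side Sa →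
                          Incident G e w → Incident G e′ w → ⊥
  OwnSides-meet-nowhere (e∈Sa , e∉Sb) e′∈Sb e′∉Sa inc inc′ =
    a≢b (trans (sym (meets-only-at Sa e∈Sa e′∉Sa inc inc′)) (meets-only-at Sb e′∈Sb e∉Sb inc′ inc))

-- Subdivisions of G4

module _ {G : Graph} where
  open Walks G
  open Lollipop using (stem; cycle; cycle-nonempty)

  NonemptyWalk : Vtx G → Vtx G → Set
  NonemptyWalk x y = Σ (Walk G x y) λ w → 0 < length (walkEdges w)

  subdivision : (H : Graph) (φ : Vtx H → Vtx G)
    (path : (e : Edg H) → NonemptyWalk (φ (proj₁ (ends H e))) (φ (proj₂ (ends H e)))) →
    Unique (tabulate φ ++ concat (map (λ e → innerVerts (proj₁ (path e))) (allFin (nE H)))) →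
    Unique (concat (map (λ e → walkEdges (proj₁ (path e))) (allFin (nE H)))) →
    SubdivisionIn H G
  subdivision H φ path verts-unique edges-unique with Unique-++⁻ (tabulate φ) verts-unique
  ... | branch-unique , inner-unique , disjoint = record
    { φ             = φ
    ; φ-inj         = Unique-tabulate⇒injective branch-unique
    ; path          = proj₁ ∘ path
    ; path-nonempty = proj₂ ∘ path
    ; inner-unique  = inner-unique
    ; inner-new     = λ e → All.tabulate λ w∈ i φi≡w →
        disjoint (subst (_∈ tabulate φ) φi≡w (∈-tabulate⁺ i) ,
                  ∈-concat⁺′ w∈ (∈-map⁺ (λ e → innerVerts (proj₁ (path e))) (∈-allFin e)))
    ; edges-unique  = edges-unique
    }

  record Dumbbell {u v : Vtx G} (Lu : Lollipop G u) (Lv : Lollipop G v) : Set where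
    field
      {e₁ e₂ e₃}      : Edg G
      joins₁          : Joins G e₁ u v
      joins₂          : Joins G e₂ u v
      joins₃          : Joins G e₃ u v
      vertices-unique : Unique (vertices Lu ++ vertices Lv)
      edges-unique    : Unique (e₁ ∷ e₂ ∷ e₃ ∷ edges Lu ++ edges Lv)

  module _ {u v : Vtx G} {Lu : Lollipop G u} {Lv : Lollipop G v} (D : Dumbbell Lu Lv) where
    open Dumbbell D

    Dumbbell-swap : Dumbbell Lv Lu
    Dumbbell-swap = record
      { joins₁          = Joins-sym joins₁
      ; joins₂          = Joins-sym joins₂
      ; joins₃          = Joins-sym joins₃
      ; vertices-unique = Unique-resp-↭ (++-comm (vertices Lu) (vertices Lv)) vertices-unique
      ; edges-unique    = Unique-resp-↭ (++⁺ˡ (e₁ ∷ e₂ ∷ e₃ ∷ []) (++-comm (edges Lu) (edges Lv))) edges-unique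
      }

    -- Listed as u, v, y, z, the vertex numbering of the G4 graphs.
    branch-vertices : List (Vtx G)
    branch-vertices = u ∷ v ∷ tips Lu ++ tips Lv

    -- The pieces are concatenated in the edge order of the G4 graphs, so that these lists become
    -- the ones required by subdivision as soon as the stems are known to be empty or not.
    branch-and-inner-unique :
      Unique (branch-vertices ++ innerVerts (stem Lu) ++ innerVerts (stem Lv) ++
                                 innerVerts (cycle Lu) ++ innerVerts (cycle Lv) ++ [])
    branch-and-inner-unique = Unique-resp-↭ regroup vertices-unique
      where
      regroup : vertices Lu ++ vertices Lv ↭
                branch-vertices ++ innerVerts (stem Lu) ++ innerVerts (stem Lv) ++
                                   innerVerts (cycle Lu) ++ innerVerts (cycle Lv) ++ []
      regroup = ↭-trans (++⁺ (vertices-↭ Lu) (vertices-↭ Lv))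
               (↭-trans (↭-gather u v (tips Lu) (inner Lu) (tips Lv) (inner Lv))
                        (++⁺ˡ branch-vertices (↭-interleave (innerVerts (stem Lu)) (innerVerts (cycle Lu))
                                                            (innerVerts (stem Lv)) (innerVerts (cycle Lv)))))

    pieces-edges-unique :
      Unique (e₁ ∷ e₂ ∷ e₃ ∷ walkEdges (stem Lu) ++ walkEdges (stem Lv) ++
                             walkEdges (cycle Lu) ++ walkEdges (cycle Lv) ++ [])
    pieces-edges-unique = Unique-resp-↭ (++⁺ˡ (e₁ ∷ e₂ ∷ e₃ ∷ []) regroup) edges-unique
      where
      regroup : edges Lu ++ edges Lv ↭
                walkEdges (stem Lu) ++ walkEdges (stem Lv) ++ walkEdges (cycle Lu) ++ walkEdges (cycle Lv) ++ []
      regroup = ↭-trans (++⁺ (↭-reflexive (walkEdges-++ʷ (stem Lu) (cycle Lu)))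
                             (↭-reflexive (walkEdges-++ʷ (stem Lv) (cycle Lv))))
                        (↭-interleave (walkEdges (stem Lu)) (walkEdges (cycle Lu))
                                      (walkEdges (stem Lv)) (walkEdges (cycle Lv)))

  edge⁺ : ∀ {e x y} → Joins G e x y → NonemptyWalk x y
  edge⁺ j = edge j , s≤s z≤n

  cycle⁺ : ∀ {u} (L : Lollipop G u) → NonemptyWalk (Lollipop.tip L) (Lollipop.tip L)
  cycle⁺ L = cycle L , cycle-nonempty L

  Dumbbell⇒G4 : ∀ {u v} (Lu : Lollipop G u) (Lv : Lollipop G v) → Dumbbell Lu Lv →
                ∃ λ H → IsG4 H × SubdivisionIn H G
  Dumbbell⇒G4 Lu@(lollipop (cons _ _ _) _ _ _ _) Lv@(lollipop (cons _ _ _) _ _ _ _) D =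
    G4-base , g4-base , subdivision G4-base φ path (branch-and-inner-unique D) (pieces-edges-unique D)
    where
    open Dumbbell D
    φ : Vtx G4-base → Vtx G
    φ = lookup (branch-vertices D)
    path : (e : Edg G4-base) → NonemptyWalk (φ (proj₁ (ends G4-base e))) (φ (proj₂ (ends G4-base e)))
    path f0                               = edge⁺ joins₁
    path (fs f0)                          = edge⁺ joins₂
    path (fs (fs f0))                     = edge⁺ joins₃
    path (fs (fs (fs f0)))                = stem Lu , s≤s z≤n
    path (fs (fs (fs (fs f0))))           = stem Lv , s≤s z≤n
    path (fs (fs (fs (fs (fs f0)))))      = cycle⁺ Lu
    path (fs (fs (fs (fs (fs (fs f0)))))) = cycle⁺ Lv
  Dumbbell⇒G4 Lu@(lollipop nil _ _ _ _) Lv@(lollipop (cons _ _ _) _ _ _ _) D =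
    G4-uy , g4-uy , subdivision G4-uy φ path (branch-and-inner-unique D) (pieces-edges-unique D)
    where
    open Dumbbell D
    φ : Vtx G4-uy → Vtx G
    φ = lookup (branch-vertices D)
    path : (e : Edg G4-uy) → NonemptyWalk (φ (proj₁ (ends G4-uy e))) (φ (proj₂ (ends G4-uy e)))
    path f0                          = edge⁺ joins₁
    path (fs f0)                     = edge⁺ joins₂
    path (fs (fs f0))                = edge⁺ joins₃
    path (fs (fs (fs f0)))           = stem Lv , s≤s z≤n
    path (fs (fs (fs (fs f0))))      = cycle⁺ Lu
    path (fs (fs (fs (fs (fs f0))))) = cycle⁺ Lv
  -- G4-vz is G4-uy with u and v exchanged.
  Dumbbell⇒G4 Lu@(lollipop (cons _ _ _) _ _ _ _) Lv@(lollipop nil _ _ _ _) D =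
    Dumbbell⇒G4 Lv Lu (Dumbbell-swap D)
  Dumbbell⇒G4 Lu@(lollipop nil _ _ _ _) Lv@(lollipop nil _ _ _ _) D =
    G4-both , g4-both , subdivision G4-both φ path (branch-and-inner-unique D) (pieces-edges-unique D)
    where
    open Dumbbell D
    φ : Vtx G4-both → Vtx G
    φ = lookup (branch-vertices D)
    path : (e : Edg G4-both) → NonemptyWalk (φ (proj₁ (ends G4-both e))) (φ (proj₂ (ends G4-both e)))
    path f0                     = edge⁺ joins₁
    path (fs f0)                = edge⁺ joins₂
    path (fs (fs f0))           = edge⁺ joins₃
    path (fs (fs (fs f0)))      = cycle⁺ Lu
    path (fs (fs (fs (fs f0)))) = cycle⁺ Lv

skein-between-cut-vertices⇒G4 : ∀ {G} → (∀ v → 3 ≤ deg G v) → ∀ {a b} → a ≢ b →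
  (ψ : Fin 3 → Edg G) → Injective _≡_ _≡_ ψ → (∀ i → Joins G (ψ i) a b) →
  CutVertex G a → CutVertex G b → ∃ λ H → IsG4 H × SubdivisionIn H G
skein-between-cut-vertices⇒G4 {G} deg≥3 {a} {b} a≢b ψ ψ-inj joins cut-a cut-b
  with cutVertex⇒separation cut-a (ψ f0) | cutVertex⇒separation cut-b (ψ f0)
... | Sa , ψ₀∉Sa | Sb , ψ₀∉Sb = Dumbbell⇒G4 La Lb dumbbell
  where
  open Walks G
  module A = TwoSeparations a≢b Sa Sb (joins f0) ψ₀∉Sa ψ₀∉Sb
  module B = TwoSeparations (a≢b ∘ sym) Sb Sa (Joins-sym (joins f0)) ψ₀∉Sb ψ₀∉Sa

  La : Lollipop G a
  La = proj₁ (A.OwnSide-lollipop deg≥3)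
  Lb : Lollipop G b
  Lb = proj₁ (B.OwnSide-lollipop deg≥3)
  La-own : All A.OwnSide (edges La)
  La-own = proj₂ (A.OwnSide-lollipop deg≥3)
  Lb-own : All B.OwnSide (edges Lb)
  Lb-own = proj₂ (B.OwnSide-lollipop deg≥3)

  vertices-disjoint : Disjoint (vertices La) (vertices Lb)
  vertices-disjoint (w∈La , w∈Lb) with vertex-on-edge La w∈La | vertex-on-edge Lb w∈Lb
  ... | e , e∈La , inc | e′ , e′∈Lb , inc′ with All.lookup Lb-own e′∈Lb
  ...   | e′∈Sb , e′∉Sa = A.OwnSides-meet-nowhere (All.lookup La-own e∈La) e′∈Sb e′∉Sa inc inc′

  edges-disjoint : Disjoint (edges La) (edges Lb)
  edges-disjoint (e∈La , e∈Lb) = proj₂ (All.lookup Lb-own e∈Lb) (proj₁ (All.lookup La-own e∈La))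

  skein-disjoint : Disjoint (tabulate ψ) (edges La ++ edges Lb)
  skein-disjoint (e∈ψ , e∈L) with ∈-tabulate⁻ {f = ψ} e∈ψ | ∈-++⁻ (edges La) e∈L
  ... | i , refl | inj₁ e∈La = A.joining-edge∉side (joins i) (proj₁ (All.lookup La-own e∈La))
  ... | i , refl | inj₂ e∈Lb = B.joining-edge∉side (Joins-sym (joins i)) (proj₁ (All.lookup Lb-own e∈Lb))

  dumbbell : Dumbbell La Lb
  dumbbell = record
    { joins₁          = joins f0
    ; joins₂          = joins (fs f0)
    ; joins₃          = joins (fs (fs f0))
    ; vertices-unique = UniqueP.++⁺ (Lollipop.vertices-unique La) (Lollipop.vertices-unique Lb) vertices-disjoint
    ; edges-unique    = UniqueP.++⁺ (UniqueP.tabulate⁺ ψ-inj)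
                          (UniqueP.++⁺ (Lollipop.edges-unique La) (Lollipop.edges-unique Lb) edges-disjoint)
                          skein-disjoint
    }

lemma5 : (G : Graph) → SeriesParallel G → (∀ v → 3 ≤ deg G v) →
         (∀ H → IsG4 H → ¬ SubdivisionIn H G) →
         (B : Subgraph G) → Block B → IsoTo (skein 3) B → Endblock B
lemma5 G _ deg≥3 no-G4 B block (φ , ψ , φ-inj , φ-onto , _ , ψ-inj , _ , _ , joins) = block , one-cut-vertex
  where
  open Walks G

  not-both-cut : ∀ {a b} → a ≢ b → (∀ i → Joins G (ψ i) a b) → CutVertex G a → CutVertex G b → ⊥
  not-both-cut a≢b joins-ab cut-a cut-b with skein-between-cut-vertices⇒G4 deg≥3 a≢b ψ ψ-inj joins-ab cut-a cut-b
  ... | H , isG4 , subdivision = no-G4 H isG4 subdivision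

  φ₀≢φ₁ : φ f0 ≢ φ (fs f0)
  φ₀≢φ₁ eq with φ-inj eq
  ... | ()

  one-cut-vertex : ∀ x y → x ∈ₛ vs B → y ∈ₛ vs B → CutVertex G x → CutVertex G y → x ≡ y
  one-cut-vertex x y x∈B y∈B cut-x cut-y with φ-onto x x∈B | φ-onto y y∈B
  ... | f0    , refl | f0    , refl = refl
  ... | fs f0 , refl | fs f0 , refl = refl
  ... | f0    , refl | fs f0 , refl = ⊥-elim (not-both-cut φ₀≢φ₁ joins cut-x cut-y)
  ... | fs f0 , refl | f0    , refl = ⊥-elim (not-both-cut (φ₀≢φ₁ ∘ sym) (Joins-sym ∘ joins) cut-x cut-y)
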